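{- Let $X$ be a type with distinguished element $0_X$, let $R$ be a type, let $q\colon X^{\mathbb{N}}\to R$, $\omega\colon X^{\mathbb{N}}\to\mathbb{N}$, and let $(\varepsilon_s)_{s\in X^\ast}$ be selection functions $\varepsilon_s\colon (X\to R)\to X$. Let $(\mathrm{EPS}_s)_{s\in X^\ast}$, with $\mathrm{EPS}_s\colon (X^{\mathbb{N}}\to R)\to X^{\mathbb{N}}$, be the explicitly controlled unbounded product of the $\varepsilon_s$ with control $\omega$, i.e. a family satisfying, for all $s\in X^\ast$ and all $r\colon X^{\mathbb{N}}\to R$, $$\mathrm{EPS}_s(r)=\begin{cases}\mathbf{0} & \text{if } \omega(\hat s)<|s|,\\ a_s\ast \mathrm{EPS}_{s\ast a_s}(r_{a_s}) & \text{otherwise},\end{cases}\qquad a_s=\varepsilon_s\big(\lambda x.\, r(x\ast \mathrm{EPS}_{s\ast x}(r_x))\big).$$ Define $\alpha=\mathrm{EPS}_{\langle\rangle}(q)$ and, for $s\in X^\ast$ and $x\in X$, $p_s(x)=q_{s\ast x}\big(\mathrm{EPS}_{s\ast x}(q_{s\ast x})\big)$. Then for every $n\le\omega(\alpha)$, $$\alpha(n)=\varepsilon_{[\alpha](n)}\big(p_{[\alpha](n)}\big)\quad\text{and}\quad q(\alpha)=p_{[\alpha](n)}\Big(\varepsilon_{[\alpha](n)}\big(p_{[\alpha](n)}\big)\Big).$$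
   Context: $X^\ast$ is the type of finite sequences over $X$, $X^{\mathbb{N}}$ of infinite sequences. $s\ast t$ denotes concatenation, $|s|$ is the length of $s$, $\mathbf{0}$ is the constant sequence $0_X,0_X,\dots$, $\hat s=s\ast\mathbf{0}$, $[\alpha](n)=\langle\alpha(0),\dots,\alpha(n-1)\rangle$, and for a finite sequence (or element) $a$, $r_a(\beta)=r(a\ast\beta)$. All functions are extensional. -}

module Defs where

open import Data.Nat using (ℕ; zero; suc; _<_)
open import Data.List using (List; []; _∷_; length) renaming (_++_ to _++ₗ_)
open import Data.List.Base using ([_])
open import Relation.Binary.PropositionalEquality using (_≡_)

Seq : Set → Set
Seq X = ℕ → X

_≈_ : {X : Set} → Seq X → Seq X → Set
α ≈ β = ∀ n → α n ≡ β n

_⊕_ : {X : Set} → List X → Seq X → Seq X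
([] ⊕ α) n = α n
((x ∷ s) ⊕ α) zero = x
((x ∷ s) ⊕ α) (suc n) = (s ⊕ α) n

_∷ʳ'_ : {X : Set} → List X → X → List X
s ∷ʳ' x = s ++ₗ [ x ]

𝟎 : {X : Set} → X → Seq X
𝟎 z _ = z

hat : {X : Set} → X → List X → Seq X
hat z s = s ⊕ 𝟎 z

init : {X : Set} → Seq X → ℕ → List X
init α zero = []
init α (suc n) = α zero ∷ init (λ k → α (suc k)) n

shift : {X R : Set} → (Seq X → R) → List X → (Seq X → R)
shift r a β = r (a ⊕ β)

Ext : {X R : Set} → (Seq X → R) → Set
Ext {X} r = ∀ (α β : Seq X) → α ≈ β → r α ≡ r β

ExtSel : {X R : Set} → ((X → R) → X) → Set
ExtSel {X} {R} e = ∀ (f g : X → R) → (∀ x → f x ≡ g x) → e f ≡ e g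

ExtEPS : {X R : Set} → ((Seq X → R) → Seq X) → Set
ExtEPS {X} {R} E = ∀ (r r' : Seq X → R) → (∀ α → r α ≡ r' α) → E r ≈ E r'

aSel : {X R : Set} → (List X → (X → R) → X) → (List X → (Seq X → R) → Seq X)
     → List X → (Seq X → R) → X
aSel ε EPS s r = ε s (λ x → r ([ x ] ⊕ EPS (s ∷ʳ' x) (shift r [ x ])))

IsEPS : {X R : Set} → X → (Seq X → ℕ) → (List X → (X → R) → X)
      → (List X → (Seq X → R) → Seq X) → Set
IsEPS {X} {R} z ω ε EPS =
  ∀ (s : List X) (r : Seq X → R) →
    (ω (hat z s) < length s → EPS s r ≈ 𝟎 z)
  × (¬ (ω (hat z s) < length s) →
       EPS s r ≈ ([ aSel ε EPS s r ] ⊕ EPS (s ∷ʳ' aSel ε EPS s r) (shift r [ aSel ε EPS s r ])))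
  where
  open import Data.Product using (_×_)
  open import Relation.Nullary using (¬_)

pFun : {X R : Set} → (Seq X → R) → (List X → (Seq X → R) → Seq X) → List X → X → R
pFun q EPS s x = shift q (s ∷ʳ' x) (EPS (s ∷ʳ' x) (shift q (s ∷ʳ' x)))

-- Call a finite sequence s "on the path" of α = EPS⟨⟩(q) when α = s ∗ EPS_s(q_s). The empty
-- sequence is on the path, and if s is on the path with |s| ≤ ω(α), then the control cannot
-- have stopped at s: otherwise EPS_s(q_s) = 0, so α = ŝ and ω(α) = ω(ŝ) < |s|. Unfolding the
-- defining equation once therefore puts s ∗ a_s on the path, where a_s = ε_s(p_s) by
-- extensionality. By induction [α](n) is on the path for n ≤ ω(α), which gives both claims.
module Submission where

open import Defs
open import Data.Nat using (ℕ; zero; suc; _≤_; _<_)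
open import Data.Nat.Properties using (≤-trans; ≤-reflexive; ≤⇒≯; <⇒≤)
open import Data.List using (List; []; _∷_; length; _++_; [_])
open import Data.Product using (_×_; _,_; proj₁; proj₂)
open import Relation.Nullary using (¬_)
open import Relation.Binary.PropositionalEquality using (_≡_; refl; sym; trans; cong; subst)

module _ {X : Set} where

  ≈-trans : {α β γ : Seq X} → α ≈ β → β ≈ γ → α ≈ γ
  ≈-trans p q n = trans (p n) (q n)

  ⊕-congˡ : (s : List X) {β γ : Seq X} → β ≈ γ → (s ⊕ β) ≈ (s ⊕ γ)
  ⊕-congˡ []      p n       = p n
  ⊕-congˡ (x ∷ s) p zero    = refl
  ⊕-congˡ (x ∷ s) p (suc n) = ⊕-congˡ s p n

  ⊕-assoc : (s t : List X) (β : Seq X) → (s ⊕ (t ⊕ β)) ≈ ((s ++ t) ⊕ β)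
  ⊕-assoc []      t β n       = refl
  ⊕-assoc (x ∷ s) t β zero    = refl
  ⊕-assoc (x ∷ s) t β (suc n) = ⊕-assoc s t β n

  ∷ʳ'-⊕-length : (s : List X) (x : X) (β : Seq X) → ((s ∷ʳ' x) ⊕ β) (length s) ≡ x
  ∷ʳ'-⊕-length []      x β = refl
  ∷ʳ'-⊕-length (y ∷ s) x β = ∷ʳ'-⊕-length s x β

  length-init : (α : Seq X) (n : ℕ) → length (init α n) ≡ n
  length-init α zero    = refl
  length-init α (suc n) = cong suc (length-init (λ k → α (suc k)) n)

  init-suc : (α : Seq X) (n : ℕ) → init α (suc n) ≡ init α n ∷ʳ' α n
  init-suc α zero    = refl
  init-suc α (suc n) = cong (α zero ∷_) (init-suc (λ k → α (suc k)) n)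

  shift-shift : {R : Set} (r : Seq X → R) → Ext r →
                (s t : List X) (β : Seq X) → shift (shift r s) t β ≡ shift r (s ++ t) β
  shift-shift r ext s t β = ext _ _ (⊕-assoc s t β)

module Path {X R : Set} (z : X) (q : Seq X → R) (ω : Seq X → ℕ)
         (ε : List X → (X → R) → X) (EPS : List X → (Seq X → R) → Seq X)
         (ext-q : Ext q) (ext-ω : Ext ω)
         (ext-ε : ∀ s → ExtSel (ε s)) (ext-EPS : ∀ s → ExtEPS (EPS s))
         (isEPS : IsEPS z ω ε EPS) where

  α : Seq X
  α = EPS [] q

  next : List X → X
  next s = ε s (pFun q EPS s)

  OnPath : List X → Set
  OnPath s = α ≈ (s ⊕ EPS s (shift q s))

  EPS-shift-∷ʳ' : (s : List X) (x : X) →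
                  EPS (s ∷ʳ' x) (shift (shift q s) [ x ]) ≈ EPS (s ∷ʳ' x) (shift q (s ∷ʳ' x))
  EPS-shift-∷ʳ' s x = ext-EPS (s ∷ʳ' x) _ _ (shift-shift q ext-q s [ x ])

  aSel-shift : (s : List X) → aSel ε EPS s (shift q s) ≡ next s
  aSel-shift s = ext-ε s _ _ λ x →
    ext-q _ _ (≈-trans (⊕-assoc s [ x ] _) (⊕-congˡ (s ∷ʳ' x) (EPS-shift-∷ʳ' s x)))

  not-stopped : (s : List X) → OnPath s → length s ≤ ω α → ¬ (ω (hat z s) < length s)
  not-stopped s on le stop = ≤⇒≯ (≤-trans le (≤-reflexive (ext-ω _ _ α≈ŝ))) stop
    where
    α≈ŝ : α ≈ hat z s
    α≈ŝ = ≈-trans on (⊕-congˡ s (proj₁ (isEPS s (shift q s)) stop))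

  next-on-path : (s : List X) → OnPath s → length s ≤ ω α → OnPath (s ∷ʳ' next s)
  next-on-path s on le = subst (λ a → OnPath (s ∷ʳ' a)) (aSel-shift s) unfolded
    where
    a : X
    a = aSel ε EPS s (shift q s)
    unfolded : OnPath (s ∷ʳ' a)
    unfolded =
      ≈-trans on
      (≈-trans (⊕-congˡ s (proj₂ (isEPS s (shift q s)) (not-stopped s on le)))
      (≈-trans (⊕-assoc s [ a ] _)
               (⊕-congˡ (s ∷ʳ' a) (EPS-shift-∷ʳ' s a))))

  on-path-lookup : (s : List X) (x : X) → OnPath (s ∷ʳ' x) → α (length s) ≡ x
  on-path-lookup s x on = trans (on (length s)) (∷ʳ'-⊕-length s x _)

  on-path-q : (s : List X) (x : X) → OnPath (s ∷ʳ' x) → q α ≡ pFun q EPS s x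
  on-path-q s x on = ext-q _ _ on

  init-next-on-path : (n : ℕ) → n ≤ ω α → OnPath (init α n) →
                      OnPath (init α n ∷ʳ' next (init α n))
  init-next-on-path n le on =
    next-on-path (init α n) on (subst (_≤ ω α) (sym (length-init α n)) le)

  lookup-next : (n : ℕ) → n ≤ ω α → OnPath (init α n) → α n ≡ next (init α n)
  lookup-next n le on =
    subst (λ m → α m ≡ next (init α n)) (length-init α n)
      (on-path-lookup (init α n) _ (init-next-on-path n le on))

  init-on-path : (n : ℕ) → n ≤ ω α → OnPath (init α n)
  init-on-path zero    le k = refl
  init-on-path (suc n) le   =
    subst OnPath (sym (trans (init-suc α n) (cong (init α n ∷ʳ'_) (lookup-next n le′ on))))
      (init-next-on-path n le′ on)
    where
    le′ : n ≤ ω α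
    le′ = <⇒≤ le
    on : OnPath (init α n)
    on = init-on-path n le′

theorem2p6 : (X : Set) (z : X) (R : Set) (q : Seq X → R) (ω : Seq X → ℕ)
    (ε : List X → (X → R) → X) (EPS : List X → (Seq X → R) → Seq X) →
    Ext q → Ext ω → (∀ s → ExtSel (ε s)) → (∀ s → ExtEPS (EPS s)) →
    IsEPS z ω ε EPS →
    let α = EPS [] q in
    (n : ℕ) → n ≤ ω α →
      (α n ≡ ε (init α n) (pFun q EPS (init α n)))
      × (q α ≡ pFun q EPS (init α n) (ε (init α n) (pFun q EPS (init α n))))
theorem2p6 X z R q ω ε EPS ext-q ext-ω ext-ε ext-EPS isEPS n le =
  lookup-next n le on , on-path-q (init α n) _ (init-next-on-path n le on)
  where
  open Path z q ω ε EPS ext-q ext-ω ext-ε ext-EPS isEPS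
  on : OnPath (init α n)
  on = init-on-path n le
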